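{- Let $\mathcal{M}=(W,\le,N,V)$ be a coherent and Cartesian intuitionistic neighbourhood model. (1) If $w,v,u\in W$ satisfy $wR^{\sim}v$ and $v\le u$, then there exists $s\in W$ with $w\le s$ and $sR^{\sim}u$. (2) If $\mathcal{M}$ is Cartesian, then $wR^{\sim}v\le^{\sim}u$ and $wR^{\sim}v'\le^{\sim}u$ imply $v=v'$.
   Context: Intuitionistic neighbourhood model: $(W,\le,N,V)$ with $(W,\le)$ a poset, $N$ a set of partial functions $a:W\rightharpoonup\mathcal{P}(W)$ whose domains $\mathrm{dom}(a)$ are upsets, $V$ mapping proposition letters to upsets. $a$ is coherent if (N1) whenever $w\le w'$, $w\in\mathrm{dom}(a)$ and $v\in a(w)$, there is $v'\in a(w')$ with $v\le v'$; (N2) whenever $v\in a(w)$ and $v\le v'$, there is $w'\ge w$ with $v'\in a(w')$; the model is coherent if all its neighbourhoods are. Define $wRv$ iff $v\in a(w)$ for some $a\in N$; $R^{\sim}$ is the equivalence closure of $R$ and $\le^{\sim}$ the equivalence closure of $\le$. The model is $R^{\sim}$-Cartesian if $w\le^{\sim}v\,R^{\sim}\,w$ implies $w=v$; N-Cartesian if $wR^{\sim}v$ and $w,v\in\mathrm{dom}(a)$ imply $a(w)=a(v)$ for all $a\in N$; Cartesian if both. Chains like $wR^{\sim}v\le^{\sim}u$ mean $wR^{\sim}v$ and $v\le^{\sim}u$. -}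

module Defs where

open import Level using (0ℓ)
open import Data.Nat using (ℕ)
open import Data.Product using (Σ; ∃; _×_; _,_)
open import Relation.Binary.PropositionalEquality using (_≡_)
open import Relation.Binary.Structures using (IsPartialOrder)
open import Relation.Binary.Construct.Closure.Equivalence using (EqClosure)

-- A set of partial functions a : W ⇀ P(W) is represented by an index set I;
-- for a : I, (dom a) is the domain of a, and for w ∈ dom a, (nb a w d) is
-- the subset a(w) ⊆ W (as a predicate).
record NbhdModel : Set₁ where
  field
    W       : Set
    _≤_     : W → W → Set
    isPO    : IsPartialOrder _≡_ _≤_
    I       : Set
    dom     : I → W → Set
    dom-up  : ∀ a {w w'} → w ≤ w' → dom a w → dom a w'
    nb      : (a : I) → (w : W) → dom a w → W → Set
    V       : ℕ → W → Set
    V-up    : ∀ p {w w'} → w ≤ w' → V p w → V p w'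

module _ (M : NbhdModel) where
  open NbhdModel M

  -- (N1) and (N2) for a single neighbourhood function a
  Coherent₁ : I → Set
  Coherent₁ a =
    (∀ {w w' v} (w≤w' : w ≤ w') (d : dom a w) → nb a w d v →
       ∃ λ v' → nb a w' (dom-up a w≤w' d) v' × (v ≤ v'))
    × (∀ {w v v'} (d : dom a w) → nb a w d v → v ≤ v' →
       ∃ λ w' → Σ (w ≤ w') λ w≤w' → nb a w' (dom-up a w≤w' d) v')

  Coherent : Set
  Coherent = ∀ a → Coherent₁ a

  R : W → W → Set
  R w v = ∃ λ a → Σ (dom a w) λ d → nb a w d v

  R~ : W → W → Set
  R~ = EqClosure R

  ≤~ : W → W → Set
  ≤~ = EqClosure _≤_

  R~-Cartesian : Set
  R~-Cartesian = ∀ {w v} → ≤~ w v → R~ v w → w ≡ v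

  N-Cartesian : Set
  N-Cartesian = ∀ a {w v} → R~ w v → (dw : dom a w) (dv : dom a v) →
    ∀ x → (nb a w dw x → nb a v dv x) × (nb a v dv x → nb a w dw x)

  Cartesian : Set
  Cartesian = R~-Cartesian × N-Cartesian

{-# OPTIONS --safe #-}
module Submission where

open import Defs
open import Data.Product using (∃; _×_; _,_; proj₁; proj₂)
open import Relation.Binary.PropositionalEquality using (_≡_)
open import Relation.Binary.Construct.Closure.ReflexiveTransitive using (ε; _◅_)
open import Relation.Binary.Construct.Closure.Symmetric using (SymClosure; fwd; bwd)
open import Relation.Binary.Construct.Closure.Equivalence as EqClosure using ()

-- (1): an R~-path from w to v followed by v ≤ u is pushed, one R-edge at a
-- time from the v end, to w ≤ s followed by an R~-path from s to u; forward
-- edges are lifted by (N2), backward edges by (N1).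
-- (2): the two hypotheses give v ≤~ v' and v' R~ v, so R~-Cartesianness
-- alone forces v = v'.

module _ (M : NbhdModel) where
  open NbhdModel M

  module _ (coh : Coherent M) where

    R-≤-lift : ∀ {w x y} → R M w x → x ≤ y → ∃ λ s → w ≤ s × R M s y
    R-≤-lift (a , d , x∈aw) x≤y with proj₂ (coh a) d x∈aw x≤y
    ... | s , w≤s , y∈as = s , w≤s , (a , _ , y∈as)

    R⁻¹-≤-lift : ∀ {w x y} → R M x w → x ≤ y → ∃ λ s → w ≤ s × R M y s
    R⁻¹-≤-lift (a , d , w∈ax) x≤y with proj₁ (coh a) x≤y d w∈ax
    ... | s , s∈ay , w≤s = s , w≤s , (a , _ , s∈ay)

    SymClosure-≤-lift : ∀ {w x y} → SymClosure (R M) w x → x ≤ y →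
      ∃ λ s → w ≤ s × SymClosure (R M) s y
    SymClosure-≤-lift (fwd wRx) x≤y with R-≤-lift wRx x≤y
    ... | s , w≤s , sRy = s , w≤s , fwd sRy
    SymClosure-≤-lift (bwd xRw) x≤y with R⁻¹-≤-lift xRw x≤y
    ... | s , w≤s , yRs = s , w≤s , bwd yRs

    R~-≤-lift : ∀ {w v u} → R~ M w v → v ≤ u → ∃ λ s → w ≤ s × R~ M s u
    R~-≤-lift {u = u} ε v≤u = u , v≤u , ε
    R~-≤-lift (w~x ◅ x~v) v≤u with R~-≤-lift x~v v≤u
    ... | t , x≤t , t~u with SymClosure-≤-lift w~x x≤t
    ... | s , w≤s , s~t = s , w≤s , (s~t ◅ t~u)

  R~-Cartesian⇒cospan-unique : R~-Cartesian M →
    ∀ {w v v' u} → R~ M w v → ≤~ M v u → R~ M w v' → ≤~ M v' u → v ≡ v'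
  R~-Cartesian⇒cospan-unique cart w~v v≤~u w~v' v'≤~u =
    cart (EqClosure.transitive _≤_ v≤~u (EqClosure.symmetric _≤_ v'≤~u))
         (EqClosure.transitive (R M) (EqClosure.symmetric (R M) w~v') w~v)

lemma3p17 : (M : NbhdModel) → Coherent M → Cartesian M →
    (∀ {w v u} → R~ M w v → NbhdModel._≤_ M v u →
       ∃ λ s → NbhdModel._≤_ M w s × R~ M s u)
    × (∀ {w v v' u} → R~ M w v → ≤~ M v u → R~ M w v' → ≤~ M v' u → v ≡ v')
lemma3p17 M coh (R~-cart , _) =
  R~-≤-lift M coh , R~-Cartesian⇒cospan-unique M R~-cart
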